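{- Let $\alpha\neq 0$ and $a$ be complex numbers with $a\notin\{0,-\alpha,-2\alpha,\ldots\}$. For integers $n\ge 0$ and $k\in\mathbb{Z}$, the two-parameter Hurwitz-Lerch type poly-Cauchy numbers of the second kind satisfy $$\widehat{c}_n^{(k)}(\alpha,a)=(-1)^n\sum_{m=0}^{n}\left[{n\atop m}\right]\frac{1}{(\alpha m+a)^k}.$$
   Context: The factorial two-parameter Hurwitz-Lerch zeta function is $\Phi_f(z,s,\alpha,a)=\sum_{n=0}^{\infty}\frac{z^n}{n!(\alpha n+a)^s}$. The numbers $\widehat{c}_n^{(k)}(\alpha,a)$ are defined by the (formal power series) generating function $\Phi_f(-\ln(1+t),k,\alpha,a)=\sum_{n=0}^{\infty}\widehat{c}_n^{(k)}(\alpha,a)\frac{t^n}{n!}$. Here $\left[{n\atop m}\right]$ denotes the (unsigned) Stirling numbers of the first kind, defined by $\frac{(\ln(1+t))^m}{m!}=\sum_{n=0}^\infty(-1)^{n-m}\left[{n\atop m}\right]\frac{t^n}{n!}$. -}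

module Defs where

open import Level using (Level; _⊔_) renaming (suc to lsuc)
open import Algebra.Bundles using (CommutativeRing)
open import Data.Nat as ℕ using (ℕ; zero; suc; _∸_)
open import Data.Integer as ℤ using (ℤ; +_; -[1+_])
open import Relation.Nullary using (¬_)

stirling1 : ℕ → ℕ → ℕ
stirling1 zero    zero    = 1
stirling1 zero    (suc m) = 0
stirling1 (suc n) zero    = 0
stirling1 (suc n) (suc m) = n ℕ.* stirling1 n (suc m) ℕ.+ stirling1 n m

-- A field of characteristic zero (ℂ is an instance).

natEmb : {c ℓ : Level} (R : CommutativeRing c ℓ) → ℕ → CommutativeRing.Carrier R
natEmb R zero    = CommutativeRing.0# R
natEmb R (suc n) = CommutativeRing._+_ R (CommutativeRing.1# R) (natEmb R n)

record CharZeroField (c ℓ : Level) : Set (lsuc (c ⊔ ℓ)) where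
  field
    commutativeRing : CommutativeRing c ℓ
  open CommutativeRing commutativeRing public
  field
    0≉1         : ¬ (0# ≈ 1#)
    inv         : (x : Carrier) → ¬ (x ≈ 0#) → Carrier
    inv-inverse : (x : Carrier) (p : ¬ (x ≈ 0#)) → x * inv x p ≈ 1#

    char0       : (n : ℕ) → ¬ (natEmb commutativeRing (suc n) ≈ 0#)

  ι : ℕ → Carrier
  ι = natEmb commutativeRing

module FieldOps {c ℓ : Level} (F : CharZeroField c ℓ) where
  open CharZeroField F

  pow : Carrier → ℕ → Carrier
  pow x zero    = 1#
  pow x (suc n) = x * pow x n

  zpow : (x : Carrier) → ¬ (x ≈ 0#) → ℤ → Carrier
  zpow x p (+ n)      = pow x n
  zpow x p -[1+ n ]   = pow (inv x p) (suc n)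

  invPow : (x : Carrier) → ¬ (x ≈ 0#) → ℤ → Carrier
  invPow x p k = zpow x p (ℤ.- k)

  sgn : ℕ → Carrier
  sgn n = pow (- 1#) n

  fact : ℕ → Carrier
  fact n = ι (n ℕ.!)

  invFact : ℕ → Carrier
  invFact zero    = 1#
  invFact (suc n) = inv (ι (suc n)) (char0 n) * invFact n

  sumTo : (ℕ → Carrier) → ℕ → Carrier
  sumTo f zero    = f 0
  sumTo f (suc n) = sumTo f n + f (suc n)

  Series : Set c
  Series = ℕ → Carrier

  oneS : Series
  oneS zero    = 1#
  oneS (suc n) = 0#

  mulS : Series → Series → Series
  mulS f g n = sumTo (λ i → f i * g (n ∸ i)) n

  powS : Series → ℕ → Series
  powS f zero    = oneS
  powS f (suc m) = mulS f (powS f m)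

  -- composition  (Σ_m φ_m z^m) ∘ g  for a series g with zero constant
  -- term: the coefficient of t^n only involves m ≤ n.
  compS : Series → Series → Series
  compS φ g n = sumTo (λ m → φ m * powS g m n) n

  -- ln(1+t) = Σ_{n≥1} (-1)^{n-1} t^n / n
  logS : Series
  logS zero    = 0#
  logS (suc n) = sgn n * inv (ι (suc n)) (char0 n)

  negLogS : Series
  negLogS n = - logS n

  PhiF : (k : ℤ) (α a : Carrier) → ((m : ℕ) → ¬ (α * ι m + a ≈ 0#)) → Series
  PhiF k α a ha m = invFact m * invPow (α * ι m + a) (ha m) k

  -- ĉ_n^{(k)}(α,a):  Φ_f(-ln(1+t),k,α,a) = Σ_n ĉ_n t^n / n!
  chat : (n : ℕ) (k : ℤ) (α a : Carrier) → ((m : ℕ) → ¬ (α * ι m + a ≈ 0#)) → Carrier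
  chat n k α a ha = fact n * compS (PhiF k α a ha) negLogS n

-- Write L = -ln(1+t).  Since (1+t) L′ = -1, the Leibniz rule gives
-- (1+t) (L^{m+1})′ = -(m+1) L^m.  Read coefficientwise, this shows that
-- n! [tⁿ] L^m and m! (-1)ⁿ [n m] satisfy the same recurrence, so they agree;
-- in the composition defining ĉ_n^{(k)}(α,a) the factor m! then cancels the
-- 1/m! of Φ_f.
module Submission where

open import Defs
open import Level using (Level)
open import Data.Nat using (ℕ)
open import Data.Integer using (ℤ)
open import Relation.Nullary using (¬_)
open import Data.Nat as ℕ using (zero; suc; _∸_; _!; _≤_; z≤n)
import Data.Nat.Properties as ℕ
import Relation.Binary.PropositionalEquality as ≡

module CharZeroFieldSeries {c ℓ : Level} (F : CharZeroField c ℓ) where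
  open CharZeroField F
  open FieldOps F
  open import Algebra.Properties.Ring ring using (-1*x≈-x)
  open import Algebra.Properties.Group +-group using (ε⁻¹≈ε; //-rightDividesʳ; //-cong₂)
  open import Algebra.Properties.Semiring.Mult semiring using (_×_; ×-homo-+; ×1-homo-*)
  open import Algebra.Solver.Ring.NaturalCoefficients.Default commutativeSemiring
    using (solve; _:=_; _:+_; _:*_; con)
  open import Relation.Binary.Reasoning.Setoid setoid

  -1*x+x≈0 : ∀ x → - 1# * x + x ≈ 0#
  -1*x+x≈0 x = trans (+-congʳ (-1*x≈-x x)) (-‿inverseˡ x)

  x+y≈z⇒x≈z-y : ∀ {x y z} → x + y ≈ z → x ≈ z - y
  x+y≈z⇒x≈z-y {x} {y} x+y≈z = trans (sym (//-rightDividesʳ y x)) (//-cong₂ x+y≈z refl)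

  ι≈×1 : ∀ n → ι n ≈ n × 1#
  ι≈×1 zero    = refl
  ι≈×1 (suc n) = +-congˡ (ι≈×1 n)

  ι-1 : ι 1 ≈ 1#
  ι-1 = +-identityʳ 1#

  ι-homo-+ : ∀ m n → ι (m ℕ.+ n) ≈ ι m + ι n
  ι-homo-+ m n = begin
    ι (m ℕ.+ n)      ≈⟨ ι≈×1 (m ℕ.+ n) ⟩
    (m ℕ.+ n) × 1#   ≈⟨ ×-homo-+ 1# m n ⟩
    m × 1# + n × 1#  ≈⟨ +-cong (ι≈×1 m) (ι≈×1 n) ⟨
    ι m + ι n        ∎

  ι-homo-* : ∀ m n → ι (m ℕ.* n) ≈ ι m * ι n
  ι-homo-* m n = begin
    ι (m ℕ.* n)          ≈⟨ ι≈×1 (m ℕ.* n) ⟩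
    (m ℕ.* n) × 1#       ≈⟨ ×1-homo-* m n ⟩
    (m × 1#) * (n × 1#)  ≈⟨ *-cong (ι≈×1 m) (ι≈×1 n) ⟨
    ι m * ι n            ∎

  ι-stirling1-suc : ∀ n m →
    ι (stirling1 (suc n) (suc m)) ≈ ι n * ι (stirling1 n (suc m)) + ι (stirling1 n m)
  ι-stirling1-suc n m =
    trans (ι-homo-+ (n ℕ.* stirling1 n (suc m)) (stirling1 n m))
          (+-congʳ (ι-homo-* n (stirling1 n (suc m))))

  sumTo-cong : ∀ {f g} n → (∀ i → i ≤ n → f i ≈ g i) → sumTo f n ≈ sumTo g n
  sumTo-cong zero    f≈g = f≈g 0 z≤n
  sumTo-cong (suc n) f≈g =
    +-cong (sumTo-cong n (λ i i≤n → f≈g i (ℕ.m≤n⇒m≤1+n i≤n))) (f≈g (suc n) ℕ.≤-refl)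

  sumTo-+ : ∀ f g n → sumTo (λ i → f i + g i) n ≈ sumTo f n + sumTo g n
  sumTo-+ f g zero    = refl
  sumTo-+ f g (suc n) = begin
    sumTo (λ i → f i + g i) n + (f (suc n) + g (suc n))
      ≈⟨ +-congʳ (sumTo-+ f g n) ⟩
    (sumTo f n + sumTo g n) + (f (suc n) + g (suc n))
      ≈⟨ solve 4 (λ a b x y → (a :+ b) :+ (x :+ y) := (a :+ x) :+ (b :+ y)) refl
           (sumTo f n) (sumTo g n) (f (suc n)) (g (suc n)) ⟩
    (sumTo f n + f (suc n)) + (sumTo g n + g (suc n)) ∎

  *-distribˡ-sumTo : ∀ x f n → x * sumTo f n ≈ sumTo (λ i → x * f i) n
  *-distribˡ-sumTo x f zero    = refl
  *-distribˡ-sumTo x f (suc n) = trans (distribˡ x _ _) (+-congʳ (*-distribˡ-sumTo x f n))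

  sumTo-≈0 : ∀ f n → (∀ i → f i ≈ 0#) → sumTo f n ≈ 0#
  sumTo-≈0 f zero    f≈0 = f≈0 0
  sumTo-≈0 f (suc n) f≈0 = trans (+-cong (sumTo-≈0 f n f≈0) (f≈0 (suc n))) (+-identityˡ 0#)

  sumTo-suc : ∀ f n → sumTo f (suc n) ≈ f 0 + sumTo (λ i → f (suc i)) n
  sumTo-suc f zero    = refl
  sumTo-suc f (suc n) = trans (+-congʳ (sumTo-suc f n)) (+-assoc _ _ _)

  mulS-congʳ : ∀ {f f′} g → (∀ i → f i ≈ f′ i) → ∀ n → mulS f g n ≈ mulS f′ g n
  mulS-congʳ g f≈f′ n = sumTo-cong n (λ i _ → *-congʳ (f≈f′ i))

  mulS-congˡ : ∀ f {g g′} → (∀ i → g i ≈ g′ i) → ∀ n → mulS f g n ≈ mulS f g′ n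
  mulS-congˡ f g≈g′ n = sumTo-cong n (λ i _ → *-congˡ (g≈g′ (n ∸ i)))

  mulS-*ˡ : ∀ x f g n → mulS (λ i → x * f i) g n ≈ x * mulS f g n
  mulS-*ˡ x f g n =
    trans (sumTo-cong n (λ i _ → *-assoc x (f i) (g (n ∸ i)))) (sym (*-distribˡ-sumTo x _ n))

  mulS-*ʳ : ∀ x f g n → mulS f (λ i → x * g i) n ≈ x * mulS f g n
  mulS-*ʳ x f g n =
    trans (sumTo-cong n (λ i _ → x-comm (f i) (g (n ∸ i)))) (sym (*-distribˡ-sumTo x _ n))
    where
    x-comm : ∀ y z → y * (x * z) ≈ x * (y * z)
    x-comm = solve 3 (λ x y z → y :* (x :* z) := x :* (y :* z)) refl x

  mulS-suc-head : ∀ f g n →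
    mulS f g (suc n) ≈ f 0 * g (suc n) + sumTo (λ i → f (suc i) * g (n ∸ i)) n
  mulS-suc-head f g n = sumTo-suc (λ i → f i * g (suc n ∸ i)) n

  mulS-suc-last : ∀ f g n →
    mulS f g (suc n) ≈ sumTo (λ i → f i * g (suc (n ∸ i))) n + f (suc n) * g 0
  mulS-suc-last f g n = +-cong
    (sumTo-cong n (λ i i≤n → *-congˡ (reflexive (≡.cong g (ℕ.+-∸-assoc 1 i≤n)))))
    (*-congˡ (reflexive (≡.cong g (ℕ.n∸n≡0 n))))

  mulS-identityˡ : ∀ g n → mulS oneS g n ≈ g n
  mulS-identityˡ g zero    = *-identityˡ (g 0)
  mulS-identityˡ g (suc n) = begin
    mulS oneS g (suc n)                             ≈⟨ mulS-suc-head oneS g n ⟩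
    1# * g (suc n) + sumTo (λ i → 0# * g (n ∸ i)) n
      ≈⟨ +-cong (*-identityˡ _) (sumTo-≈0 _ n (λ i → zeroˡ _)) ⟩
    g (suc n) + 0#                                  ≈⟨ +-identityʳ _ ⟩
    g (suc n)                                       ∎

  -- Coefficientwise, θ f = t f′ and δ f = (1 + t) f′.
  θ : Series → Series
  θ f n = ι n * f n

  δ : Series → Series
  δ f n = θ f (suc n) + θ f n

  θ-zero : ∀ f → θ f 0 ≈ 0#
  θ-zero f = zeroˡ (f 0)

  θ-mulS : ∀ f g n → θ (mulS f g) n ≈ mulS (θ f) g n + mulS f (θ g) n
  θ-mulS f g n = begin
    ι n * sumTo (λ i → f i * g (n ∸ i)) n
      ≈⟨ *-distribˡ-sumTo (ι n) _ n ⟩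
    sumTo (λ i → ι n * (f i * g (n ∸ i))) n
      ≈⟨ sumTo-cong n split ⟩
    sumTo (λ i → θ f i * g (n ∸ i) + f i * θ g (n ∸ i)) n
      ≈⟨ sumTo-+ _ _ n ⟩
    mulS (θ f) g n + mulS f (θ g) n ∎
    where
    split : ∀ i → i ≤ n → ι n * (f i * g (n ∸ i)) ≈ θ f i * g (n ∸ i) + f i * θ g (n ∸ i)
    split i i≤n = begin
      ι n * (f i * g (n ∸ i))
        ≈⟨ *-congʳ (reflexive (≡.cong ι (ℕ.m+[n∸m]≡n i≤n))) ⟨
      ι (i ℕ.+ (n ∸ i)) * (f i * g (n ∸ i))
        ≈⟨ *-congʳ (ι-homo-+ i (n ∸ i)) ⟩
      (ι i + ι (n ∸ i)) * (f i * g (n ∸ i))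
        ≈⟨ solve 4 (λ a b x y → (a :+ b) :* (x :* y) := (a :* x) :* y :+ x :* (b :* y)) refl
             (ι i) (ι (n ∸ i)) (f i) (g (n ∸ i)) ⟩
      θ f i * g (n ∸ i) + f i * θ g (n ∸ i) ∎

  δ-mulS : ∀ f g n → δ (mulS f g) n ≈ mulS (δ f) g n + mulS f (δ g) n
  δ-mulS f g n = begin
    θ (mulS f g) (suc n) + θ (mulS f g) n
      ≈⟨ +-cong (θ-mulS f g (suc n)) (θ-mulS f g n) ⟩
    (mulS (θ f) g (suc n) + mulS f (θ g) (suc n)) + (C + D)
      ≈⟨ +-congʳ (+-cong (mulS-suc-head (θ f) g n) (mulS-suc-last f (θ g) n)) ⟩
    ((θ f 0 * g (suc n) + A) + (B + f (suc n) * θ g 0)) + (C + D)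
      ≈⟨ +-congʳ (+-cong (+-congʳ (trans (*-congʳ (θ-zero f)) (zeroˡ _)))
                         (+-congˡ (trans (*-congˡ (θ-zero g)) (zeroʳ _)))) ⟩
    ((0# + A) + (B + 0#)) + (C + D)
      ≈⟨ +-congʳ (+-cong (+-identityˡ A) (+-identityʳ B)) ⟩
    (A + B) + (C + D)
      ≈⟨ solve 4 (λ a b x y → (a :+ b) :+ (x :+ y) := (a :+ x) :+ (b :+ y)) refl A B C D ⟩
    (A + C) + (B + D)
      ≈⟨ +-cong (sumTo-+ _ _ n) (sumTo-+ _ _ n) ⟨
    sumTo (λ i → θ f (suc i) * g (n ∸ i) + θ f i * g (n ∸ i)) n
      + sumTo (λ i → f i * θ g (suc (n ∸ i)) + f i * θ g (n ∸ i)) n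
      ≈⟨ +-cong (sumTo-cong n (λ i _ → distribʳ _ _ _)) (sumTo-cong n (λ i _ → distribˡ _ _ _)) ⟨
    mulS (δ f) g n + mulS f (δ g) n ∎
    where
    A = sumTo (λ i → θ f (suc i) * g (n ∸ i)) n
    B = sumTo (λ i → f i * θ g (suc (n ∸ i))) n
    C = mulS (θ f) g n
    D = mulS f (θ g) n

  δ-oneS : ∀ n → δ oneS n ≈ 0#
  δ-oneS zero    = trans (+-cong (zeroʳ _) (zeroˡ _)) (+-identityˡ 0#)
  δ-oneS (suc n) = trans (+-cong (zeroʳ _) (zeroʳ _)) (+-identityˡ 0#)

  δ-powS-suc : ∀ {f} x → (∀ n → δ f n ≈ x * oneS n) →
               ∀ m n → δ (powS f (suc m)) n ≈ x * (ι (suc m) * powS f m n)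
  δ-powS-suc {f} x δf≈x m n = begin
    δ (mulS f (powS f m)) n
      ≈⟨ δ-mulS f (powS f m) n ⟩
    mulS (δ f) (powS f m) n + mulS f (δ (powS f m)) n
      ≈⟨ +-cong δf-part (powS-part m) ⟩
    x * powS f m n + x * (ι m * powS f m n)
      ≈⟨ solve 3 (λ x i g → x :* g :+ x :* (i :* g) := x :* ((con 1 :+ i) :* g)) refl
           x (ι m) (powS f m n) ⟩
    x * ((1# + ι m) * powS f m n) ∎
    where
    δf-part : mulS (δ f) (powS f m) n ≈ x * powS f m n
    δf-part = begin
      mulS (δ f) (powS f m) n                ≈⟨ mulS-congʳ (powS f m) δf≈x n ⟩
      mulS (λ i → x * oneS i) (powS f m) n   ≈⟨ mulS-*ˡ x oneS (powS f m) n ⟩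
      x * mulS oneS (powS f m) n             ≈⟨ *-congˡ (mulS-identityˡ (powS f m) n) ⟩
      x * powS f m n                         ∎
    powS-part : ∀ m → mulS f (δ (powS f m)) n ≈ x * (ι m * powS f m n)
    powS-part zero = trans (sumTo-≈0 _ n (λ i → trans (*-congˡ (δ-oneS (n ∸ i))) (zeroʳ _)))
                           (sym (trans (*-congˡ (zeroˡ _)) (zeroʳ _)))
    powS-part (suc m) = begin
      mulS f (δ (powS f (suc m))) n
        ≈⟨ mulS-congˡ f (δ-powS-suc x δf≈x m) n ⟩
      mulS f (λ i → x * (ι (suc m) * powS f m i)) n
        ≈⟨ mulS-*ʳ x f (λ i → ι (suc m) * powS f m i) n ⟩
      x * mulS f (λ i → ι (suc m) * powS f m i) n
        ≈⟨ *-congˡ (mulS-*ʳ (ι (suc m)) f (powS f m) n) ⟩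
      x * (ι (suc m) * powS f (suc m) n) ∎

  θ-negLogS-suc : ∀ n → θ negLogS (suc n) ≈ sgn (suc n)
  θ-negLogS-suc n = begin
    ι (suc n) * - (sgn n * v)           ≈⟨ *-congˡ (-1*x≈-x _) ⟨
    ι (suc n) * (- 1# * (sgn n * v))
      ≈⟨ solve 4 (λ x a s w → x :* (a :* (s :* w)) := (a :* s) :* (x :* w)) refl
           (ι (suc n)) (- 1#) (sgn n) v ⟩
    (- 1# * sgn n) * (ι (suc n) * v)     ≈⟨ *-congˡ (inv-inverse _ _) ⟩
    (- 1# * sgn n) * 1#                  ≈⟨ *-identityʳ _ ⟩
    - 1# * sgn n                         ∎
    where v = inv (ι (suc n)) (char0 n)

  δ-negLogS : ∀ n → δ negLogS n ≈ - 1# * oneS n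
  δ-negLogS zero    = trans (+-cong (θ-negLogS-suc 0) (θ-zero negLogS)) (+-identityʳ _)
  δ-negLogS (suc n) = begin
    θ negLogS (suc (suc n)) + θ negLogS (suc n) ≈⟨ +-cong (θ-negLogS-suc (suc n)) (θ-negLogS-suc n) ⟩
    - 1# * sgn (suc n) + sgn (suc n)             ≈⟨ -1*x+x≈0 (sgn (suc n)) ⟩
    0#                                           ≈⟨ zeroʳ (- 1#) ⟨
    - 1# * 0#                                    ∎

  powS-negLogS-suc : ∀ m n →
    ι (suc n) * powS negLogS (suc m) (suc n) ≈
      - 1# * (ι (suc m) * powS negLogS m n) + - 1# * (ι n * powS negLogS (suc m) n)
  powS-negLogS-suc m n =
    trans (x+y≈z⇒x≈z-y (δ-powS-suc (- 1#) δ-negLogS m n)) (+-congˡ (sym (-1*x≈-x _)))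

  factorial-powS-negLogS : ∀ m n →
    ι (n !) * powS negLogS m n ≈ ι (m !) * (sgn n * ι (stirling1 n m))
  factorial-powS-negLogS zero zero = *-congˡ (sym (trans (*-identityˡ _) ι-1))
  factorial-powS-negLogS zero (suc n) = trans (zeroʳ _) (sym (trans (*-congˡ (zeroʳ _)) (zeroʳ _)))
  factorial-powS-negLogS (suc m) zero = begin
    ι 1 * (- 0# * powS negLogS m 0)  ≈⟨ *-congˡ (trans (*-congʳ ε⁻¹≈ε) (zeroˡ _)) ⟩
    ι 1 * 0#                        ≈⟨ zeroʳ _ ⟩
    0#                              ≈⟨ trans (*-congˡ (zeroʳ _)) (zeroʳ _) ⟨
    ι (suc m !) * (1# * 0#)         ∎
  factorial-powS-negLogS (suc m) (suc n) = begin
    ι (suc n ℕ.* n !) * G′ (suc n)        ≈⟨ *-congʳ (ι-homo-* (suc n) (n !)) ⟩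
    (ι (suc n) * ι (n !)) * G′ (suc n)
      ≈⟨ solve 3 (λ a b g → (a :* b) :* g := b :* (a :* g)) refl (ι (suc n)) (ι (n !)) (G′ (suc n)) ⟩
    ι (n !) * (ι (suc n) * G′ (suc n))    ≈⟨ *-congˡ (powS-negLogS-suc m n) ⟩
    ι (n !) * (s * (A * G n) + s * (ι n * G′ n))
      ≈⟨ solve 6 (λ k s A g i g′ → k :* (s :* (A :* g) :+ s :* (i :* g′))
                                    := s :* (A :* (k :* g)) :+ s :* (i :* (k :* g′))) refl
           (ι (n !)) s A (G n) (ι n) (G′ n) ⟩
    s * (A * (ι (n !) * G n)) + s * (ι n * (ι (n !) * G′ n))
      ≈⟨ +-cong (*-congˡ (*-congˡ (factorial-powS-negLogS m n)))
                (*-congˡ (*-congˡ (factorial-powS-negLogS (suc m) n))) ⟩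
    s * (A * (B * (S * X))) + s * (ι n * (ι (suc m ℕ.* m !) * (S * Y)))
      ≈⟨ +-congˡ (*-congˡ (*-congˡ (*-congʳ (ι-homo-* (suc m) (m !))))) ⟩
    s * (A * (B * (S * X))) + s * (ι n * ((A * B) * (S * Y)))
      ≈⟨ solve 7 (λ s A B S X i Y →
            s :* (A :* (B :* (S :* X))) :+ s :* (i :* ((A :* B) :* (S :* Y)))
              := (A :* B) :* ((s :* S) :* (i :* Y :+ X))) refl s A B S X (ι n) Y ⟩
    (A * B) * ((s * S) * (ι n * Y + X))
      ≈⟨ *-cong (ι-homo-* (suc m) (m !)) (*-congˡ (ι-stirling1-suc n m)) ⟨
    ι (suc m ℕ.* m !) * (sgn (suc n) * ι (stirling1 (suc n) (suc m))) ∎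
    where
    G  = powS negLogS m
    G′ = powS negLogS (suc m)
    s  = - 1#
    A  = ι (suc m)
    B  = ι (m !)
    S  = sgn n
    X  = ι (stirling1 n m)
    Y  = ι (stirling1 n (suc m))

  invFact-inverseʳ : ∀ m → ι (m !) * invFact m ≈ 1#
  invFact-inverseʳ zero    = trans (*-identityʳ _) ι-1
  invFact-inverseʳ (suc m) = begin
    ι (suc m ℕ.* m !) * (v * invFact m)           ≈⟨ *-congʳ (ι-homo-* (suc m) (m !)) ⟩
    (ι (suc m) * ι (m !)) * (v * invFact m)
      ≈⟨ solve 4 (λ x k v i → (x :* k) :* (v :* i) := (x :* v) :* (k :* i)) refl
           (ι (suc m)) (ι (m !)) v (invFact m) ⟩
    (ι (suc m) * v) * (ι (m !) * invFact m)       ≈⟨ *-cong (inv-inverse _ _) (invFact-inverseʳ m) ⟩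
    1# * 1#                                       ≈⟨ *-identityˡ 1# ⟩
    1#                                            ∎
    where v = inv (ι (suc m)) (char0 m)

  factorial-compS-negLogS : ∀ φ n →
    ι (n !) * compS φ negLogS n ≈ sgn n * sumTo (λ m → ι (stirling1 n m) * (ι (m !) * φ m)) n
  factorial-compS-negLogS φ n = begin
    ι (n !) * sumTo (λ m → φ m * powS negLogS m n) n
      ≈⟨ *-distribˡ-sumTo (ι (n !)) _ n ⟩
    sumTo (λ m → ι (n !) * (φ m * powS negLogS m n)) n
      ≈⟨ sumTo-cong n (λ m _ → term m) ⟩
    sumTo (λ m → sgn n * (ι (stirling1 n m) * (ι (m !) * φ m))) n
      ≈⟨ *-distribˡ-sumTo (sgn n) _ n ⟨
    sgn n * sumTo (λ m → ι (stirling1 n m) * (ι (m !) * φ m)) n ∎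
    where
    term : ∀ m → ι (n !) * (φ m * powS negLogS m n) ≈ sgn n * (ι (stirling1 n m) * (ι (m !) * φ m))
    term m = begin
      ι (n !) * (φ m * powS negLogS m n)
        ≈⟨ solve 3 (λ k f g → k :* (f :* g) := f :* (k :* g)) refl (ι (n !)) (φ m) (powS negLogS m n) ⟩
      φ m * (ι (n !) * powS negLogS m n)
        ≈⟨ *-congˡ (factorial-powS-negLogS m n) ⟩
      φ m * (ι (m !) * (sgn n * ι (stirling1 n m)))
        ≈⟨ solve 4 (λ f k s x → f :* (k :* (s :* x)) := s :* (x :* (k :* f))) refl
             (φ m) (ι (m !)) (sgn n) (ι (stirling1 n m)) ⟩
      sgn n * (ι (stirling1 n m) * (ι (m !) * φ m)) ∎

theorem3 : {c ℓ : Level} (F : CharZeroField c ℓ) →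
    let open CharZeroField F
        open FieldOps F
    in (α a : Carrier) → ¬ (α ≈ 0#) →
       (ha : (m : ℕ) → ¬ (α * ι m + a ≈ 0#)) →
       (n : ℕ) (k : ℤ) →
       chat n k α a ha ≈
         sgn n * sumTo (λ m → ι (stirling1 n m) * invPow (α * ι m + a) (ha m) k) n
theorem3 F α a _ ha n k = begin
    fact n * compS (PhiF k α a ha) negLogS n
      ≈⟨ factorial-compS-negLogS (PhiF k α a ha) n ⟩
    sgn n * sumTo (λ m → ι (stirling1 n m) * (ι (m !) * (invFact m * w m))) n
      ≈⟨ *-congˡ (sumTo-cong n (λ m _ → *-congˡ (cancel-factorial m))) ⟩
    sgn n * sumTo (λ m → ι (stirling1 n m) * w m) n ∎
  where
  open CharZeroField F
  open FieldOps F
  open CharZeroFieldSeries F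
  open import Relation.Binary.Reasoning.Setoid setoid

  w : ℕ → Carrier
  w m = invPow (α * ι m + a) (ha m) k

  cancel-factorial : ∀ m → ι (m !) * (invFact m * w m) ≈ w m
  cancel-factorial m =
    trans (sym (*-assoc _ _ _)) (trans (*-congʳ (invFact-inverseʳ m)) (*-identityˡ (w m)))
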